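{- Let $(A_1,\dots,A_n)$ and $(B_1,\dots,B_m)$ be nonempty sequences of words, and let the $n$-bounded index collection $(g_1,\dots,g_r)$ and the $m$-bounded index collection $(h_1,\dots,h_t)$ be maximal for them, respectively. Let $k=\max(\{0\}\cup\{i\mid 1\le i\le r,\ B_{h_1}\precsim A_{g_i}\})$. Then the $(n+m)$-bounded index collection $(g_1,\dots,g_k,n+h_1,\dots,n+h_t)$ is maximal for the sequence $(A_1,\dots,A_n,B_1,\dots,B_m)$.
   Context: A word is a finite string over $\mathbb{N}$; $\Lambda$ is the empty word. $\mathsf{S}_k$ is the set of words all of whose symbols are $\ge k$. A relation $\precsim$ on words is defined by induction on (maximal symbol minus minimal symbol) of $AB$: $\Lambda\precsim\Lambda$; if $AB$ is nonempty with minimal symbol $n$, write uniquely $A=A_1n\dots nA_k$, $B=B_1n\dots nB_l$ with $k,l\ge1$ and all $A_i,B_j\in\mathsf{S}_{n+1}$; let $(C_i)$, $(D_j)$ be lexicographically maximal subsequences of $(A_1,\dots,A_k)$, $(B_1,\dots,B_l)$; then $A\precsim B$ iff $(C_i)$ is lexicographically not greater than $(D_j)$. Here $(X_1,\dots,X_p)$ is lexicographically not greater than $(Y_1,\dots,Y_q)$ iff either $p\le q$ and $X_i\sim Y_i$ for all $i\le p$, or there is $s<\min(p,q)$ with $X_i\sim Y_i$ for $i\le s$ and $X_{s+1}\precsim Y_{s+1}$; $A\sim B$ iff $A\precsim B$ and $B\precsim A$. $\precsim$ is a linear preorder on words. An index collection is a strictly increasing finite sequence of positive integers; it is $n$-bounded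 if all entries are $\le n$. An $n$-bounded index collection $(t_1,\dots,t_r)$ corresponds to the subsequence $(A_{t_1},\dots,A_{t_r})$ of $(A_1,\dots,A_n)$; it is maximal for $(A_1,\dots,A_n)$ if this subsequence is lexicographically not less than every subsequence of $(A_1,\dots,A_n)$. -}

module Defs where

open import Data.Nat using (ℕ; zero; suc; _+_; _∸_; _≤_; _<_; _⊓_; _⊔_; _≡ᵇ_)
open import Data.Bool using (if_then_else_)
open import Data.List using (List; []; _∷_; _++_; length; foldr; map)
open import Data.List.Relation.Unary.All using (All)
open import Data.List.Relation.Unary.Linked using (Linked)
open import Data.Product using (_×_)
open import Data.Sum using (_⊎_)
open import Data.Unit using (⊤)
open import Data.Empty using (⊥)
open import Relation.Nullary using (¬_)

-- A word is a finite string over ℕ; Λ is [].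
Word : Set
Word = List ℕ

minFrom : ℕ → List ℕ → ℕ
minFrom x xs = foldr _⊓_ x xs

maxFrom : ℕ → List ℕ → ℕ
maxFrom x xs = foldr _⊔_ x xs

range : Word → ℕ
range []       = 0
range (x ∷ xs) = maxFrom x xs ∸ minFrom x xs

-- 1-based lookup with a default value for out-of-range positions
-- (only ever used at in-range positions in the statement)
at : {X : Set} → X → List X → ℕ → X
at d []       _             = d
at d (x ∷ xs) zero          = d
at d (x ∷ xs) (suc zero)    = x
at d (x ∷ xs) (suc (suc k)) = at d xs (suc k)

-- Split A = A₁ n A₂ n … n A_k into (A₁,…,A_k) (k = 1 + number of n's).
consHead : ℕ → List Word → List Word
consHead x []       = (x ∷ []) ∷ []
consHead x (w ∷ ws) = (x ∷ w) ∷ ws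

splitOn : ℕ → Word → List Word
splitOn n []       = [] ∷ []
splitOn n (x ∷ xs) =
  if x ≡ᵇ n then [] ∷ splitOn n xs else consHead x (splitOn n xs)

IndexCollection : ℕ → List ℕ → Set
IndexCollection n g = Linked _<_ g × All (λ t → 1 ≤ t × t ≤ n) g

sub : List Word → List ℕ → List Word
sub As g = map (at [] As) g

-- (X₁..X_p) lexicographically not greater than (Y₁..Y_q), relative to a
-- preorder R: either p ≤ q and Xᵢ ∼ Yᵢ for i ≤ p, or there is s < min(p,q)
-- with Xᵢ ∼ Yᵢ for i ≤ s and X_{s+1} strictly below Y_{s+1}.
LexLe : (Word → Word → Set) → List Word → List Word → Set
LexLe R []       ys       = ⊤
LexLe R (x ∷ xs) []       = ⊥
LexLe R (x ∷ xs) (y ∷ ys) =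
  (R x y × ¬ R y x) ⊎ ((R x y × R y x) × LexLe R xs ys)

IsMaximalFor : (Word → Word → Set) → List Word → List ℕ → Set
IsMaximalFor R As g =
  IndexCollection (length As) g ×
  ((h : List ℕ) → IndexCollection (length As) h → LexLe R (sub As h) (sub As g))

-- The relation ≾ with an explicit recursion budget d.  The paper's
-- definition is by induction on range(AB); all recursive comparisons are
-- between words of strictly smaller range, so budget range(AB)+1 suffices.
leqF : ℕ → Word → Word → Set
leqF d A B with A ++ B
leqF d       A B | []      = ⊤
leqF zero    A B | x ∷ xs  = ⊤                      -- unreachable (budget exhausted)
leqF (suc d) A B | x ∷ xs  =
  let n  = minFrom x xs
      As = splitOn n A
      Bs = splitOn n B
  in (C D : List ℕ) → IsMaximalFor (leqF d) As C → IsMaximalFor (leqF d) Bs D →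
     LexLe (leqF d) (sub As C) (sub Bs D)

infix 4 _≾_
_≾_ : Word → Word → Set
A ≾ B = leqF (suc (range (A ++ B))) A B

-- The preorder ≾ is represented by normal forms: finite rose trees, ordered lexicographically,
-- with A ≾ B iff nf A ≼ nf B. A word is encoded at level m by the node whose children are the
-- lexicographically maximal subsequence of the encodings, at level m + 1, of its pieces between
-- occurrences of m; this mirrors the definition of ≾, because for a total order the maximal
-- subsequence of a list is unique.
-- In a totally ordered list the maximal subsequence is computed greedily from the right and is
-- non-increasing, and an index collection is maximal iff it selects exactly this greedy list. The
-- greedy list of L ++ R is that of R preceded by those entries of the greedy list of L that are not
-- below its head y; as the list is non-increasing, they form its prefix up to the last entry ≽ y,
-- which is the prefix of length k in the statement.

module Submission where

open import Defs
open import Data.Bool using (true; false; T)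
open import Data.Empty using (⊥)
open import Data.Nat using (ℕ; zero; suc; _+_; _≤_; _<_; _≤′_; ≤′-refl; ≤′-step; z≤n; s≤s; _≡ᵇ_)
open import Data.Nat.Properties
open import Data.List using (List; []; _∷_; _++_; length; foldr; map; take)
open import Data.List.Extrema.Nat using (max; xs≤max)
open import Data.List.Properties using (map-cong-local; length-map; length-++; ++-identityʳ; map-++; take-map)
open import Data.List.Membership.Propositional using (_∈_)
open import Data.List.Membership.Propositional.Properties using (∈-++⁺ˡ; ∈-++⁺ʳ)
open import Data.List.Relation.Unary.All as All using (All; []; _∷_)
import Data.List.Relation.Unary.All.Properties as All
open import Data.List.Relation.Unary.AllPairs using (AllPairs; []; _∷_)
import Data.List.Relation.Unary.AllPairs.Properties as AllPairs
open import Data.List.Relation.Unary.Any using (here; there)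
open import Data.List.Relation.Unary.Linked as Linked using (Linked; []; [-]; _∷_)
open import Data.List.Relation.Unary.Linked.Properties using (Linked⇒AllPairs; AllPairs⇒Linked)
import Data.List.Relation.Unary.Linked.Properties as Linked
open import Data.Product using (_×_; _,_; proj₁; proj₂; ∃₂)
import Data.Product as Product
open import Data.Sum using (_⊎_; inj₁; inj₂)
import Data.Sum as Sum
open import Data.Unit using (⊤; tt)
open import Function using (_∘′_)
open import Function.Bundles using (_⇔_; mk⇔; Equivalence)
open import Function.Construct.Composition using (_⇔-∘_)
open import Function.Construct.Identity using (⇔-id)
open import Function.Construct.Symmetry using (⇔-sym)
open import Function.Properties.Equivalence using (⇔-setoid)
open import Level using (0ℓ)
open import Relation.Binary.Definitions using (Tri; tri<; tri≈; tri>)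
import Relation.Binary.Reasoning.Setoid as SetoidReasoning
open import Relation.Nullary using (¬_; Dec; yes; no; contradiction)
open import Relation.Binary.PropositionalEquality

open Equivalence using (to; from)

private
  variable
    X Y : Set

-- Rose trees and their lexicographic order

data Ordering : Set where
  LT EQ GT : Ordering

_then_ : Ordering → Ordering → Ordering
LT then _ = LT
EQ then o = o
GT then _ = GT

invert : Ordering → Ordering
invert LT = GT
invert EQ = EQ
invert GT = LT

then-EQ : ∀ o → (o then EQ) ≡ o
then-EQ LT = refl
then-EQ EQ = refl
then-EQ GT = refl

invert-then : ∀ a b → invert (a then b) ≡ invert a then invert b
invert-then LT b = refl
invert-then EQ b = refl
invert-then GT b = refl

data Tree : Set where
  node : List Tree → Tree

mutual
  compare : Tree → Tree → Ordering
  compare (node xs) (node ys) = compare* xs ys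

  compare* : List Tree → List Tree → Ordering
  compare* []       []       = EQ
  compare* []       (_ ∷ _)  = LT
  compare* (_ ∷ _)  []       = GT
  compare* (x ∷ xs) (y ∷ ys) = compare x y then compare* xs ys

mutual
  compare-refl : ∀ x → compare x x ≡ EQ
  compare-refl (node xs) = compare*-refl xs

  compare*-refl : ∀ xs → compare* xs xs ≡ EQ
  compare*-refl []       = refl
  compare*-refl (x ∷ xs) rewrite compare-refl x = compare*-refl xs

mutual
  compare-sym : ∀ x y → compare y x ≡ invert (compare x y)
  compare-sym (node xs) (node ys) = compare*-sym xs ys

  compare*-sym : ∀ xs ys → compare* ys xs ≡ invert (compare* xs ys)
  compare*-sym []       []       = refl
  compare*-sym []       (_ ∷ _)  = refl
  compare*-sym (_ ∷ _)  []       = refl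
  compare*-sym (x ∷ xs) (y ∷ ys) rewrite compare-sym x y | compare*-sym xs ys =
    sym (invert-then (compare x y) (compare* xs ys))

mutual
  compare-EQ : ∀ x y → compare x y ≡ EQ → x ≡ y
  compare-EQ (node xs) (node ys) e = cong node (compare*-EQ xs ys e)

  compare*-EQ : ∀ xs ys → compare* xs ys ≡ EQ → xs ≡ ys
  compare*-EQ []       []       _ = refl
  compare*-EQ (x ∷ xs) (y ∷ ys) e with compare x y in exy
  ... | EQ = cong₂ _∷_ (compare-EQ x y exy) (compare*-EQ xs ys e)

mutual
  compare-LT-trans : ∀ x y z → compare x y ≡ LT → compare y z ≡ LT → compare x z ≡ LT
  compare-LT-trans (node xs) (node ys) (node zs) = compare*-LT-trans xs ys zs

  compare*-LT-trans : ∀ xs ys zs → compare* xs ys ≡ LT → compare* ys zs ≡ LT → compare* xs zs ≡ LT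
  compare*-LT-trans []       (_ ∷ _)  (_ ∷ _)  _ _ = refl
  compare*-LT-trans (x ∷ xs) (y ∷ ys) (z ∷ zs) p q with compare x y in exy | compare y z in eyz
  ... | LT | LT rewrite compare-LT-trans x y z exy eyz = refl
  ... | LT | EQ rewrite compare-EQ y z eyz | exy = refl
  ... | EQ | LT rewrite compare-EQ x y exy | eyz = refl
  ... | EQ | EQ rewrite compare-EQ x y exy | compare-EQ y z eyz | compare-refl z =
    compare*-LT-trans xs ys zs p q

infix 4 _≺_ _≺*_ _≼_ _≼*_

record _≺_ (x y : Tree) : Set where
  constructor lt
  field compare≡LT : compare x y ≡ LT

_≺*_ : List Tree → List Tree → Set
xs ≺* ys = node xs ≺ node ys

≺-trans : ∀ {x y z} → x ≺ y → y ≺ z → x ≺ z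
≺-trans {x} {y} {z} (lt p) (lt q) = lt (compare-LT-trans x y z p q)

≺-irrefl : ∀ {x} → ¬ x ≺ x
≺-irrefl {x} (lt p) with () ← trans (sym (compare-refl x)) p

≺-asym : ∀ {x y} → x ≺ y → ¬ y ≺ x
≺-asym {x} {y} (lt p) (lt q) with () ← trans (sym q) (trans (compare-sym x y) (cong invert p))

≺-tri : ∀ x y → Tri (x ≺ y) (x ≡ y) (y ≺ x)
≺-tri x y = by-cases (compare x y) refl
  where
  by-cases : ∀ o → compare x y ≡ o → Tri (x ≺ y) (x ≡ y) (y ≺ x)
  by-cases LT e = tri< (lt e) (λ { refl → ≺-irrefl {x} (lt e) }) (≺-asym (lt e))
  by-cases EQ e with refl ← compare-EQ x y e = tri≈ ≺-irrefl refl ≺-irrefl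
  by-cases GT e = tri> (≺-asym y≺x) (λ { refl → ≺-irrefl y≺x }) y≺x
    where
    y≺x : y ≺ x
    y≺x = lt (trans (compare-sym x y) (cong invert e))

_≺?_ : ∀ x y → Dec (x ≺ y)
x ≺? y with ≺-tri x y
... | tri< p _ _ = yes p
... | tri≈ ¬p _ _ = no ¬p
... | tri> ¬p _ _ = no ¬p

_≼_ : Tree → Tree → Set
x ≼ y = ¬ y ≺ x

_≼*_ : List Tree → List Tree → Set
xs ≼* ys = node xs ≼ node ys

≼-refl : ∀ {x} → x ≼ x
≼-refl = ≺-irrefl

≺⇒≼ : ∀ {x y} → x ≺ y → x ≼ y
≺⇒≼ = ≺-asym

≰⇒≻ : ∀ {x y} → ¬ x ≼ y → y ≺ x
≰⇒≻ {x} {y} ¬x≼y with y ≺? x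
... | yes p = p
... | no ¬p = contradiction ¬p ¬x≼y

≺-≼-trans : ∀ {x y z} → x ≺ y → y ≼ z → x ≺ z
≺-≼-trans {y = y} {z} p q with ≺-tri y z
... | tri< y≺z _ _ = ≺-trans p y≺z
... | tri≈ _ refl _ = p
... | tri> _ _ z≺y = contradiction z≺y q

≼-≺-trans : ∀ {x y z} → x ≼ y → y ≺ z → x ≺ z
≼-≺-trans {x} {y} p q with ≺-tri x y
... | tri< x≺y _ _ = ≺-trans x≺y q
... | tri≈ _ refl _ = q
... | tri> _ _ y≺x = contradiction y≺x p

≼-trans : ∀ {x y z} → x ≼ y → y ≼ z → x ≼ z
≼-trans p q z≺x = q (≺-≼-trans z≺x p)

≼-antisym : ∀ {x y} → x ≼ y → y ≼ x → x ≡ y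
≼-antisym {x} {y} p q with ≺-tri x y
... | tri< x≺y _ _ = contradiction x≺y q
... | tri≈ _ x≡y _ = x≡y
... | tri> _ _ y≺x = contradiction y≺x p

[]-≼ : ∀ t → node [] ≼ t
[]-≼ (node []) (lt ())
[]-≼ (node (_ ∷ _)) (lt ())

[]-≼* : ∀ ys → [] ≼* ys
[]-≼* ys = []-≼ (node ys)

∷-≺* : ∀ {x y} xs ys → x ≺ y → (x ∷ xs) ≺* (y ∷ ys)
∷-≺* xs ys (lt p) = lt (cong (_then _) p)

∷-≼*⁺ : ∀ x {xs ys} → xs ≼* ys → (x ∷ xs) ≼* (x ∷ ys)
∷-≼*⁺ x p (lt q) = p (lt (trans (sym (cong (_then _) (compare-refl x))) q))

∷-≼*⁻ : ∀ x {xs ys} → (x ∷ xs) ≼* (x ∷ ys) → xs ≼* ys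
∷-≼*⁻ x p (lt q) = p (lt (trans (cong (_then _) (compare-refl x)) q))

≼*-∷ : ∀ {y ys} → All (_≼ y) ys → ys ≼* (y ∷ ys)
≼*-∷ {ys = []}     []           = []-≼* _
≼*-∷ {y} {w ∷ ws} (w≼y ∷ ws≼y) with ≺-tri w y
... | tri< w≺y _ _ = ≺⇒≼ (∷-≺* ws (w ∷ ws) w≺y)
... | tri≈ _ refl _ = ∷-≼*⁺ w (≼*-∷ ws≼y)
... | tri> _ _ y≺w = contradiction y≺w w≼y

-- Positions and index collections

at-map : ∀ (f : X → Y) d xs i → f (at d xs i) ≡ at (f d) (map f xs) i
at-map f d []       i             = refl
at-map f d (x ∷ xs) zero          = refl
at-map f d (x ∷ xs) (suc zero)    = refl
at-map f d (x ∷ xs) (suc (suc i)) = at-map f d xs (suc i)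

at-All : ∀ {P : X → Set} d {xs} i → All P xs → 1 ≤ i → i ≤ length xs → P (at d xs i)
at-All d (suc zero)    (px ∷ _)   _ _       = px
at-All d (suc (suc i)) (_  ∷ pxs) _ (s≤s q) = at-All d (suc i) pxs (s≤s z≤n) q

at-++ˡ : ∀ (d : X) xs ys i → 1 ≤ i → i ≤ length xs → at d (xs ++ ys) i ≡ at d xs i
at-++ˡ d (x ∷ xs) ys (suc zero)    _ _       = refl
at-++ˡ d (x ∷ xs) ys (suc (suc i)) _ (s≤s q) = at-++ˡ d xs ys (suc i) (s≤s z≤n) q

at-++ʳ : ∀ (d : X) xs ys i → 1 ≤ i → at d (xs ++ ys) (length xs + i) ≡ at d ys i
at-++ʳ d []       ys i       _ = refl
at-++ʳ d (x ∷ xs) ys (suc i) p rewrite +-suc (length xs) i =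
  trans (cong (at d (xs ++ ys)) (sym (+-suc (length xs) i))) (at-++ʳ d xs ys (suc i) p)

map-at-∷-suc : ∀ (d x : X) xs {g} → All (1 ≤_) g → map (at d (x ∷ xs)) (map suc g) ≡ map (at d xs) g
map-at-∷-suc d x xs []                      = refl
map-at-∷-suc d x xs {suc i ∷ g} (s≤s _ ∷ p) = cong (at d xs (suc i) ∷_) (map-at-∷-suc d x xs p)

map-sub : ∀ (f : Word → X) As g → map f (sub As g) ≡ map (at (f []) (map f As)) g
map-sub f As []      = refl
map-sub f As (i ∷ g) = cong₂ _∷_ (at-map f [] As i) (map-sub f As g)

sub-All : ∀ {P : Word → Set} {As g} → All P As → IndexCollection (length As) g → All P (sub As g)
sub-All {As = As} pAs (_ , bounds) = All.map⁺ (All.map (λ (p , q) → at-All [] _ pAs p q) bounds)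

sub-++ˡ : ∀ As Bs {g} → All (λ i → 1 ≤ i × i ≤ length As) g → sub (As ++ Bs) g ≡ sub As g
sub-++ˡ As Bs []                    = refl
sub-++ˡ As Bs {i ∷ g} ((p , q) ∷ b) = cong₂ _∷_ (at-++ˡ [] As Bs i p q) (sub-++ˡ As Bs b)

sub-++ʳ : ∀ As Bs {g} → All (1 ≤_) g → sub (As ++ Bs) (map (length As +_) g) ≡ sub Bs g
sub-++ʳ As Bs []              = refl
sub-++ʳ As Bs {i ∷ g} (p ∷ b) = cong₂ _∷_ (at-++ʳ [] As Bs i p) (sub-++ʳ As Bs b)

IndexCollection-positive : ∀ {n g} → IndexCollection n g → All (1 ≤_) g
IndexCollection-positive (_ , bounds) = All.map proj₁ bounds

IndexCollection-map-suc : ∀ {n g} → IndexCollection n g → IndexCollection (suc n) (map suc g)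
IndexCollection-map-suc (lk , bounds) =
  Linked.map⁺ (Linked.map s≤s lk) , All.map⁺ (All.map (λ (p , q) → ≤-trans p (n≤1+n _) , s≤s q) bounds)

IndexCollection-1∷map-suc : ∀ {n g} → IndexCollection n g → IndexCollection (suc n) (1 ∷ map suc g)
IndexCollection-1∷map-suc {g = g} ic@(_ , bounds) with IndexCollection-map-suc ic
... | lk , bounds′ = head-linked g bounds lk , (s≤s z≤n , s≤s z≤n) ∷ bounds′
  where
  head-linked : ∀ {n} g → All (λ i → 1 ≤ i × i ≤ n) g → Linked _<_ (map suc g) → Linked _<_ (1 ∷ map suc g)
  head-linked []      _             _  = [-]
  head-linked (i ∷ g) ((p , _) ∷ _) lk = s≤s p ∷ lk

data IndexCollectionView (n : ℕ) : List ℕ → Set where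
  skipFirst : ∀ {g} → IndexCollection n g → IndexCollectionView n (map suc g)
  useFirst  : ∀ {g} → IndexCollection n g → IndexCollectionView n (1 ∷ map suc g)

indexCollectionView : ∀ {n g} → IndexCollection (suc n) g → IndexCollectionView n g
indexCollectionView {g = []} _ = skipFirst ([] , [])
indexCollectionView {g = suc zero ∷ t} (lk , _ ∷ bounds) with indexCollectionView (Linked.tail lk , bounds)
... | skipFirst ic = useFirst ic
... | useFirst _   with s≤s () ← Linked.head lk
indexCollectionView {g = suc (suc i) ∷ t} (lk , (_ , s≤s i<n) ∷ bounds) with indexCollectionView (Linked.tail lk , bounds)
... | skipFirst (_ , bounds′) = skipFirst (Linked.map (λ { (s≤s p) → p }) (Linked.map⁻ lk) , (s≤s z≤n , i<n) ∷ bounds′)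
... | useFirst _   with s≤s () ← Linked.head lk

IndexCollection-take : ∀ {n g} k → IndexCollection n g → IndexCollection n (take k g)
IndexCollection-take k (lk , bounds) =
  AllPairs⇒Linked (AllPairs.take⁺ k (Linked⇒AllPairs <-trans lk)) , All.take⁺ k bounds

IndexCollection-++-shift : ∀ {n m a b} → IndexCollection n a → IndexCollection m b →
                           IndexCollection (n + m) (a ++ map (n +_) b)
IndexCollection-++-shift {n} {m} {a} {b} (lka , ba) (lkb , bb) = AllPairs⇒Linked increasing , bounds
  where
  shifted : Linked _<_ (map (n +_) b)
  shifted = Linked.map⁺ (Linked.map (+-monoʳ-< n) lkb)
  a<shifted : All (λ i → All (i <_) (map (n +_) b)) a
  a<shifted = All.map (λ (_ , i≤n) → All.map⁺ (All.map (λ (1≤j , _) → ≤-<-trans i≤n (m<m+n n 1≤j)) bb)) ba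
  increasing : AllPairs _<_ (a ++ map (n +_) b)
  increasing = AllPairs.++⁺ (Linked⇒AllPairs <-trans lka) (Linked⇒AllPairs <-trans shifted) a<shifted
  bounds : All (λ i → 1 ≤ i × i ≤ n + m) (a ++ map (n +_) b)
  bounds = All.++⁺ (All.map (λ (p , q) → p , ≤-trans q (m≤m+n n m)) ba)
                   (All.map⁺ (All.map (λ {j} (p , q) → ≤-trans p (m≤n+m j n) , +-monoʳ-≤ n q) bb))

at-map-sub : ∀ (f : Word → X) As g i → at (f []) (map f (sub As g)) i ≡ f (at [] As (at 0 g i))
at-map-sub f As g i = begin
  at (f []) (map f (sub As g)) i     ≡⟨ at-map f [] (sub As g) i ⟨
  f (at [] (map (at [] As) g) i)     ≡⟨ cong (λ d → f (at d (map (at [] As) g) i)) (at-zero As) ⟨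
  f (at (at [] As 0) (map (at [] As) g) i) ≡⟨ cong f (at-map (at [] As) 0 g i) ⟨
  f (at [] As (at 0 g i))            ∎
  where
  open ≡-Reasoning
  at-zero : ∀ (xs : List Word) → at [] xs 0 ≡ []
  at-zero []      = refl
  at-zero (_ ∷ _) = refl

sub-take-++-shift : ∀ As Bs k {g h} → IndexCollection (length As) g → All (1 ≤_) h →
  sub (As ++ Bs) (take k g ++ map (length As +_) h) ≡ take k (sub As g) ++ sub Bs h
sub-take-++-shift As Bs k {g} {h} (_ , bounds) h≥1 = begin
  sub (As ++ Bs) (take k g ++ map (length As +_) h)                    ≡⟨ map-++ (at [] (As ++ Bs)) (take k g) _ ⟩
  sub (As ++ Bs) (take k g) ++ sub (As ++ Bs) (map (length As +_) h)   ≡⟨ cong₂ _++_ (sub-++ˡ As Bs (All.take⁺ k bounds)) (sub-++ʳ As Bs h≥1) ⟩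
  sub As (take k g) ++ sub Bs h                                        ≡⟨ cong (_++ sub Bs h) (take-map k g) ⟨
  take k (sub As g) ++ sub Bs h                                        ∎
  where open ≡-Reasoning

-- Lexicographically maximal subsequences

BelowHead : Tree → List Tree → Set
BelowHead x []      = ⊥
BelowHead x (z ∷ _) = x ≺ z

belowHead? : ∀ x r → Dec (BelowHead x r)
belowHead? x []      = no λ ()
belowHead? x (z ∷ _) = x ≺? z

push : Tree → List Tree → List Tree
push x r with belowHead? x r
... | yes _ = r
... | no  _ = x ∷ r

greedy : List Tree → List Tree
greedy = foldr push []

NonIncreasing : List Tree → Set
NonIncreasing = AllPairs (λ x y → y ≼ x)

push-below : ∀ {x z} r → x ≺ z → push x (z ∷ r) ≡ z ∷ r
push-below {x} {z} r x≺z with x ≺? z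
... | yes _ = refl
... | no x⊀z = contradiction x≺z x⊀z

push-notBelow : ∀ {x z} r → ¬ x ≺ z → push x (z ∷ r) ≡ x ∷ z ∷ r
push-notBelow {x} {z} r x⊀z with x ≺? z
... | yes x≺z = contradiction x≺z x⊀z
... | no _ = refl

push-nonIncreasing : ∀ x {r} → NonIncreasing r → NonIncreasing (push x r)
push-nonIncreasing x {[]} [] = [] ∷ []
push-nonIncreasing x {z ∷ r} s@(r≼z ∷ _) with x ≺? z
... | yes _ = s
... | no z≼x = (z≼x ∷ All.map (λ w≼z → ≼-trans w≼z z≼x) r≼z) ∷ s

[]-≺*-greedy-∷ : ∀ t L → [] ≺* greedy (t ∷ L)
[]-≺*-greedy-∷ t L with greedy L
... | []    = lt refl
... | z ∷ r with t ≺? z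
...   | yes _ = lt refl
...   | no  _ = lt refl

greedy-nonIncreasing : ∀ L → NonIncreasing (greedy L)
greedy-nonIncreasing []      = []
greedy-nonIncreasing (x ∷ L) = push-nonIncreasing x (greedy-nonIncreasing L)

∷-≼*-push : ∀ x {s r} → s ≼* r → (x ∷ s) ≼* push x r
∷-≼*-push x {[]}    {[]} _ = ≼-refl
∷-≼*-push x {_ ∷ _} {[]} s≼[] = contradiction (lt refl) s≼[]
∷-≼*-push x {s} {z ∷ r} s≼r with x ≺? z
... | yes x≺z = ≺⇒≼ (∷-≺* s r x≺z)
... | no _ = ∷-≼*⁺ x s≼r

≼*-push : ∀ x {r} → NonIncreasing r → r ≼* push x r
≼*-push x {[]} _ = []-≼* _
≼*-push x {z ∷ r} (r≼z ∷ _) with x ≺? z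
... | yes _ = ≼-refl
... | no x⊀z with ≺-tri z x
...   | tri< z≺x _ _ = ≺⇒≼ (∷-≺* r (z ∷ r) z≺x)
...   | tri≈ _ refl _ = ∷-≼*⁺ z (≼*-∷ r≼z)
...   | tri> _ _ x≺z = contradiction x≺z x⊀z

dropBelow : Tree → List Tree → List Tree
dropBelow y []      = []
dropBelow y (a ∷ r) with a ≺? y
... | yes _ = dropBelow y r
... | no  _ = a ∷ dropBelow y r

dropBelow-below : ∀ {y z r} → All (_≼ z) r → z ≺ y → dropBelow y r ≡ []
dropBelow-below [] _ = refl
dropBelow-below {y} {r = a ∷ r} (a≼z ∷ r≼z) z≺y with a ≺? y
... | yes _ = dropBelow-below r≼z z≺y
... | no a⊀y = contradiction (≼-≺-trans a≼z z≺y) a⊀y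

push-dropBelow-++ : ∀ x y ys {r} → NonIncreasing r →
  push x (dropBelow y r ++ y ∷ ys) ≡ dropBelow y (push x r) ++ y ∷ ys
push-dropBelow-++ x y ys {[]} [] with x ≺? y
... | yes _ = refl
... | no  _ = refl
push-dropBelow-++ x y ys {z ∷ r} (r≼z ∷ _) with x ≺? z
... | yes x≺z with z ≺? y
...   | yes z≺y rewrite dropBelow-below r≼z z≺y
                      | push-below ys (≺-trans x≺z z≺y) = refl
...   | no _ rewrite push-below (dropBelow y r ++ y ∷ ys) x≺z = refl
push-dropBelow-++ x y ys {z ∷ r} (r≼z ∷ _) | no x⊀z with x ≺? y
... | yes x≺y with z ≺? y
...   | yes z≺y rewrite dropBelow-below r≼z z≺y
                      | push-below ys x≺y = refl
...   | no z⊀y = contradiction x≺y (≼-trans z⊀y x⊀z)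
push-dropBelow-++ x y ys {z ∷ r} (r≼z ∷ _) | no x⊀z | no x⊀y with z ≺? y
...   | yes z≺y rewrite dropBelow-below r≼z z≺y
                      | push-notBelow ys x⊀y = refl
...   | no _ rewrite push-notBelow (dropBelow y r ++ y ∷ ys) x⊀z = refl

greedy-++ : ∀ X {Y y ys} → greedy Y ≡ y ∷ ys → greedy (X ++ Y) ≡ dropBelow y (greedy X) ++ y ∷ ys
greedy-++ []      eq = eq
greedy-++ (x ∷ X) {y = y} {ys} eq = begin
  push x (greedy (X ++ _))              ≡⟨ cong (push x) (greedy-++ X eq) ⟩
  push x (dropBelow y (greedy X) ++ y ∷ ys) ≡⟨ push-dropBelow-++ x y ys (greedy-nonIncreasing X) ⟩
  dropBelow y (greedy (x ∷ X)) ++ y ∷ ys ∎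
  where open ≡-Reasoning

sub-≼*-greedy : ∀ d L {g} → IndexCollection (length L) g → map (at d L) g ≼* greedy L
sub-≼*-greedy d []      {[]}    _                   = ≼-refl
sub-≼*-greedy d []      {_ ∷ _} (_ , (s≤s _ , ()) ∷ _)
sub-≼*-greedy d (x ∷ L) ic with indexCollectionView ic
... | skipFirst ic′ rewrite map-at-∷-suc d x L (IndexCollection-positive ic′) =
  ≼-trans (sub-≼*-greedy d L ic′) (≼*-push x (greedy-nonIncreasing L))
... | useFirst ic′ rewrite map-at-∷-suc d x L (IndexCollection-positive ic′) =
  ∷-≼*-push x (sub-≼*-greedy d L ic′)

greedyIndices : List Tree → List ℕ
greedyIndices []      = []
greedyIndices (x ∷ L) with belowHead? x (greedy L)
... | yes _ = map suc (greedyIndices L)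
... | no  _ = 1 ∷ map suc (greedyIndices L)

greedyIndices-isIndexCollection : ∀ L → IndexCollection (length L) (greedyIndices L)
greedyIndices-isIndexCollection []      = [] , []
greedyIndices-isIndexCollection (x ∷ L) with belowHead? x (greedy L)
... | yes _ = IndexCollection-map-suc (greedyIndices-isIndexCollection L)
... | no  _ = IndexCollection-1∷map-suc (greedyIndices-isIndexCollection L)

sub-greedyIndices : ∀ d L → map (at d L) (greedyIndices L) ≡ greedy L
sub-greedyIndices d []      = refl
sub-greedyIndices d (x ∷ L) with belowHead? x (greedy L)
... | yes _ = trans (map-at-∷-suc d x L positive) (sub-greedyIndices d L)
  where positive = IndexCollection-positive (greedyIndices-isIndexCollection L)
... | no  _ = cong (x ∷_) (trans (map-at-∷-suc d x L positive) (sub-greedyIndices d L))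
  where positive = IndexCollection-positive (greedyIndices-isIndexCollection L)

NonIncreasing-at : ∀ d {L} i j → NonIncreasing L → 1 ≤ i → i ≤ j → j ≤ length L → at d L j ≼ at d L i
NonIncreasing-at d (suc zero)    (suc zero)    _             _ _       _       = ≼-refl
NonIncreasing-at d (suc zero)    (suc (suc j)) (L≼x ∷ _)     _ _       (s≤s q) = at-All d (suc j) L≼x (s≤s z≤n) q
NonIncreasing-at d (suc (suc i)) (suc (suc j)) (_ ∷ nonInc) _ (s≤s p) (s≤s q) =
  NonIncreasing-at d (suc i) (suc j) nonInc (s≤s z≤n) p q

take-dropBelow : ∀ d y L k → k ≤ length L →
  (∀ i → 1 ≤ i → i ≤ k → ¬ at d L i ≺ y) → (∀ i → k < i → i ≤ length L → at d L i ≺ y) →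
  take k L ≡ dropBelow y L
take-dropBelow d y []      zero    _       _     _     = refl
take-dropBelow d y (a ∷ L) zero    _       _     below with a ≺? y
... | yes _  = take-dropBelow d y L zero z≤n (λ { (suc _) _ () }) (λ { (suc i) _ q → below (suc (suc i)) (s≤s z≤n) (s≤s q) })
... | no a⊀y = contradiction (below 1 (s≤s z≤n) (s≤s z≤n)) a⊀y
take-dropBelow d y (a ∷ L) (suc k) (s≤s k≤) above below with a ≺? y
... | yes a≺y = contradiction a≺y (above 1 (s≤s z≤n) (s≤s z≤n))
... | no  _   = cong (a ∷_) (take-dropBelow d y L k k≤
    (λ { (suc i) _ p → above (suc (suc i)) (s≤s z≤n) (s≤s p) })
    (λ { (suc i) k<i q → below (suc (suc i)) (s≤s k<i) (s≤s q) }))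

greedy-++-take : ∀ L {R y ys} k → greedy R ≡ y ∷ ys → k ≤ length (greedy L) →
  (k ≡ 0 ⊎ (1 ≤ k × y ≼ at (node []) (greedy L) k)) →
  (∀ i → k < i → i ≤ length (greedy L) → at (node []) (greedy L) i ≺ y) →
  greedy (L ++ R) ≡ take k (greedy L) ++ greedy R
greedy-++-take L {R} {y} k eq k≤ lastAbove below = begin
  greedy (L ++ R)                  ≡⟨ greedy-++ L eq ⟩
  dropBelow y (greedy L) ++ y ∷ _  ≡⟨ cong₂ _++_ (take-dropBelow (node []) y (greedy L) k k≤ (above lastAbove) below) eq ⟨
  take k (greedy L) ++ greedy R    ∎
  where
  open ≡-Reasoning
  above : (k ≡ 0 ⊎ (1 ≤ k × y ≼ at (node []) (greedy L) k)) → ∀ i → 1 ≤ i → i ≤ k → ¬ at (node []) (greedy L) i ≺ y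
  above (inj₁ refl)       i 1≤i i≤0 = contradiction (≤-trans 1≤i i≤0) λ ()
  above (inj₂ (_ , y≼Lₖ)) i 1≤i i≤k = ≼-trans y≼Lₖ (NonIncreasing-at (node []) i k (greedy-nonIncreasing L) 1≤i i≤k k≤)

-- Maximality through an order-representing map

Represents : (Word → Word → Set) → (Word → Tree) → (Word → Set) → Set
Represents R f P = ∀ {A B} → P A → P B → R A B ⇔ f A ≼ f B

node-injective : ∀ {xs ys} → node xs ≡ node ys → xs ≡ ys
node-injective refl = refl

MaximalsLexLe : (Word → Word → Set) → List Word → List Word → Set
MaximalsLexLe R As Bs = (C D : List ℕ) → IsMaximalFor R As C → IsMaximalFor R Bs D → LexLe R (sub As C) (sub Bs D)

module _ {R : Word → Word → Set} {f : Word → Tree} {P : Word → Set} (rep : Represents R f P) where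

  LexLe⇔≼* : ∀ {As Bs} → All P As → All P Bs → LexLe R As Bs ⇔ map f As ≼* map f Bs
  LexLe⇔≼* {[]}    {Bs}    _ _ = mk⇔ (λ _ → []-≼* (map f Bs)) (λ _ → tt)
  LexLe⇔≼* {_ ∷ _} {[]}    _ _ = mk⇔ (λ ()) (λ ≼[] → contradiction (lt refl) ≼[])
  LexLe⇔≼* {A ∷ As} {B ∷ Bs} (pA ∷ pAs) (pB ∷ pBs) = mk⇔ lexLe⇒≼* ≼*⇒lexLe
    where
    tails = LexLe⇔≼* pAs pBs

    lexLe⇒≼* : LexLe R (A ∷ As) (B ∷ Bs) → map f (A ∷ As) ≼* map f (B ∷ Bs)
    lexLe⇒≼* (inj₁ (_ , ¬BA)) = ≺⇒≼ (∷-≺* _ _ (≰⇒≻ (λ fB≼fA → ¬BA (from (rep pB pA) fB≼fA))))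
    lexLe⇒≼* (inj₂ ((AB , BA) , rest))
      rewrite ≼-antisym (to (rep pA pB) AB) (to (rep pB pA) BA) = ∷-≼*⁺ (f B) (to tails rest)

    ≼*⇒lexLe : map f (A ∷ As) ≼* map f (B ∷ Bs) → LexLe R (A ∷ As) (B ∷ Bs)
    ≼*⇒lexLe fAs≼fBs with ≺-tri (f A) (f B)
    ... | tri< fA≺fB _ _ = inj₁ (from (rep pA pB) (≺⇒≼ fA≺fB) , λ BA → to (rep pB pA) BA fA≺fB)
    ... | tri≈ _ fA≡fB _ =
      inj₂ ((from (rep pA pB) (subst (f A ≼_) fA≡fB ≼-refl) , from (rep pB pA) (subst (_≼ f A) fA≡fB ≼-refl)) ,
            from tails (∷-≼*⁻ (f B) (subst (λ t → (t ∷ map f As) ≼* map f (B ∷ Bs)) fA≡fB fAs≼fBs)))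
    ... | tri> _ _ fB≺fA = contradiction (∷-≺* _ _ fB≺fA) fAs≼fBs

  map-sub-≼*-greedy : ∀ As {g} → IndexCollection (length As) g → map f (sub As g) ≼* greedy (map f As)
  map-sub-≼*-greedy As {g} ic rewrite map-sub f As g =
    sub-≼*-greedy (f []) (map f As) (subst (λ n → IndexCollection n g) (sym (length-map f As)) ic)

  greedyIndices-map-isIndexCollection : ∀ As → IndexCollection (length As) (greedyIndices (map f As))
  greedyIndices-map-isIndexCollection As =
    subst (λ n → IndexCollection n (greedyIndices (map f As))) (length-map f As) (greedyIndices-isIndexCollection (map f As))

  map-sub-greedyIndices : ∀ As → map f (sub As (greedyIndices (map f As))) ≡ greedy (map f As)
  map-sub-greedyIndices As = trans (map-sub f As _) (sub-greedyIndices (f []) (map f As))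

  isMaximalFor⇔greedy : ∀ {As g} → All P As →
    IsMaximalFor R As g ⇔ (IndexCollection (length As) g × map f (sub As g) ≡ greedy (map f As))
  isMaximalFor⇔greedy {As} {g} pAs = mk⇔ maximal⇒greedy greedy⇒maximal
    where
    maximal⇒greedy : IsMaximalFor R As g → IndexCollection (length As) g × map f (sub As g) ≡ greedy (map f As)
    maximal⇒greedy (ic , maximal) = ic , node-injective (≼-antisym (map-sub-≼*-greedy As ic) greedy≼*sub)
      where
      icᵍ = greedyIndices-map-isIndexCollection As
      greedy≼*sub : greedy (map f As) ≼* map f (sub As g)
      greedy≼*sub = subst (_≼* map f (sub As g)) (map-sub-greedyIndices As)
        (to (LexLe⇔≼* (sub-All pAs icᵍ) (sub-All pAs ic)) (maximal _ icᵍ))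

    greedy⇒maximal : IndexCollection (length As) g × map f (sub As g) ≡ greedy (map f As) → IsMaximalFor R As g
    greedy⇒maximal (ic , eq) = ic , λ h icʰ →
      from (LexLe⇔≼* (sub-All pAs icʰ) (sub-All pAs ic))
           (subst (map f (sub As h) ≼*_) (sym eq) (map-sub-≼*-greedy As icʰ))

  maximalsLexLe⇔greedy-≼* : ∀ {As Bs} → All P As → All P Bs →
    MaximalsLexLe R As Bs ⇔ greedy (map f As) ≼* greedy (map f Bs)
  maximalsLexLe⇔greedy-≼* {As} {Bs} pAs pBs = mk⇔ compareGreedy compareAny
    where
    maximalᴬ = from (isMaximalFor⇔greedy pAs) (greedyIndices-map-isIndexCollection As , map-sub-greedyIndices As)
    maximalᴮ = from (isMaximalFor⇔greedy pBs) (greedyIndices-map-isIndexCollection Bs , map-sub-greedyIndices Bs)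

    compareGreedy : MaximalsLexLe R As Bs → greedy (map f As) ≼* greedy (map f Bs)
    compareGreedy lexLe = subst₂ _≼*_ (map-sub-greedyIndices As) (map-sub-greedyIndices Bs)
      (to (LexLe⇔≼* (sub-All pAs (greedyIndices-map-isIndexCollection As)) (sub-All pBs (greedyIndices-map-isIndexCollection Bs)))
          (lexLe _ _ maximalᴬ maximalᴮ))

    compareAny : greedy (map f As) ≼* greedy (map f Bs) → MaximalsLexLe R As Bs
    compareAny greedy≼* C D maxC maxD with to (isMaximalFor⇔greedy pAs) maxC | to (isMaximalFor⇔greedy pBs) maxD
    ... | icC , eqC | icD , eqD =
      from (LexLe⇔≼* (sub-All pAs icC) (sub-All pBs icD)) (subst₂ _≼*_ (sym eqC) (sym eqD) greedy≼*)

-- Splitting words at a symbol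

minFrom≤ : ∀ x xs → All (minFrom x xs ≤_) (x ∷ xs)
minFrom≤ x []       = ≤-refl ∷ []
minFrom≤ x (y ∷ ys) with minFrom≤ x ys
... | x≥ ∷ ys≥ = ≤-trans (m⊓n≤n y _) x≥ ∷ m⊓n≤m y _ ∷ All.map (≤-trans (m⊓n≤n y _)) ys≥

≤maxFrom : ∀ x xs → All (_≤ maxFrom x xs) (x ∷ xs)
≤maxFrom x []       = ≤-refl ∷ []
≤maxFrom x (y ∷ ys) with ≤maxFrom x ys
... | x≤ ∷ ys≤ = ≤-trans x≤ (m≤n⊔m y _) ∷ m≤m⊔n y _ ∷ All.map (λ z≤ → ≤-trans z≤ (m≤n⊔m y _)) ys≤

minFrom-∈ : ∀ x xs → minFrom x xs ∈ x ∷ xs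
minFrom-∈ x []       = here refl
minFrom-∈ x (y ∷ ys) with ⊓-sel y (minFrom x ys) | minFrom-∈ x ys
... | inj₁ eq | _         rewrite eq = there (here refl)
... | inj₂ eq | here p    rewrite eq = here p
... | inj₂ eq | there p   rewrite eq = there (there p)

maxFrom-∈ : ∀ x xs → maxFrom x xs ∈ x ∷ xs
maxFrom-∈ x []       = here refl
maxFrom-∈ x (y ∷ ys) with ⊔-sel y (maxFrom x ys) | maxFrom-∈ x ys
... | inj₁ eq | _         rewrite eq = there (here refl)
... | inj₂ eq | here p    rewrite eq = here p
... | inj₂ eq | there p   rewrite eq = there (there p)

range-< : ∀ {z zs} x xs → All (λ u → u ∈ x ∷ xs × minFrom x xs < u) (z ∷ zs) → range (z ∷ zs) < range (x ∷ xs)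
range-< {z} {zs} x xs inner = ≤-<-trans (∸-monoˡ-≤ (minFrom z zs) max≤max) (∸-monoʳ-< min<min (≤-trans min≤max max≤max))
  where
  min<min : minFrom x xs < minFrom z zs
  min<min = proj₂ (All.lookup inner (minFrom-∈ z zs))
  max≤max : maxFrom z zs ≤ maxFrom x xs
  max≤max = All.lookup (≤maxFrom x xs) (proj₁ (All.lookup inner (maxFrom-∈ z zs)))
  min≤max : minFrom z zs ≤ maxFrom z zs
  min≤max = ≤-trans (All.lookup (minFrom≤ z zs) (here refl)) (All.lookup (≤maxFrom z zs) (here refl))

consHead-All : ∀ {P : ℕ → Set} {a} ws → P a → All (All P) ws → All (All P) (consHead a ws)
consHead-All []       pa _           = (pa ∷ []) ∷ []
consHead-All (w ∷ ws) pa (pw ∷ pws) = (pa ∷ pw) ∷ pws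

≡ᵇ-false : ∀ {a m} → (a ≡ᵇ m) ≡ false → a ≢ m
≡ᵇ-false {a} eq refl = subst T eq (≡⇒≡ᵇ a a refl)

splitOn-pieces : ∀ m A → All (m ≤_) A → All (All (λ z → z ∈ A × m < z)) (splitOn m A)
splitOn-pieces m []       _          = [] ∷ []
splitOn-pieces m (a ∷ as) (m≤a ∷ m≤as) with a ≡ᵇ m in eq
... | true  = [] ∷ inTail
  where inTail = All.map (All.map (λ (p , q) → there p , q)) (splitOn-pieces m as m≤as)
... | false = consHead-All (splitOn m as) (here refl , ≤∧≢⇒< m≤a (λ m≡a → ≡ᵇ-false eq (sym m≡a))) inTail
  where inTail = All.map (All.map (λ (p , q) → there p , q)) (splitOn-pieces m as m≤as)

splitOn-above : ∀ m A → All (m <_) A → splitOn m A ≡ A ∷ []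
splitOn-above m []       _            = refl
splitOn-above m (a ∷ as) (m<a ∷ m<as) with a ≡ᵇ m in eq
... | true  = contradiction (≡ᵇ⇒≡ a m (subst T (sym eq) tt)) (>⇒≢ m<a)
... | false rewrite splitOn-above m as m<as = refl

splitOn-nonempty : ∀ m A → ∃₂ λ w ws → splitOn m A ≡ w ∷ ws
splitOn-nonempty m []       = [] , [] , refl
splitOn-nonempty m (a ∷ as) with a ≡ᵇ m
... | true  = [] , splitOn m as , refl
... | false with splitOn m as
...   | []     = a ∷ [] , [] , refl
...   | w ∷ ws = a ∷ w , ws , refl

splitOn-∈ : ∀ m A → m ∈ A → 2 ≤ length (splitOn m A)
splitOn-∈ m (a ∷ as) m∈ with a ≡ᵇ m in eq | splitOn-nonempty m as
... | true  | _ , _ , split rewrite split = s≤s (s≤s z≤n)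
splitOn-∈ m (a ∷ as) (here m≡a) | false | _ = contradiction (sym m≡a) (≡ᵇ-false eq)
splitOn-∈ m (a ∷ as) (there m∈) | false | _ = ≤-trans (splitOn-∈ m as m∈) (consHead-length (splitOn m as))
  where
  consHead-length : ∀ ws → length ws ≤ length (consHead a ws)
  consHead-length []      = z≤n
  consHead-length (_ ∷ _) = ≤-refl

-- Normal forms of words

-- Each symbol value from m upwards costs one level of nesting, also when it does not occur: a word
-- whose symbols all exceed m is a single piece, so nfAt m W = node (nfAt (suc m) W ∷ []).
-- Out of fuel the value is the junk node [].
nfFuel : ℕ → ℕ → Word → Tree
nfFuel zero    m _       = node []
nfFuel (suc f) m []      = node []
nfFuel (suc f) m (x ∷ xs) = node (greedy (map (nfFuel f (suc m)) (splitOn m (x ∷ xs))))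

nfAt : ℕ → Word → Tree
nfAt m W = nfFuel (suc (max 0 W)) m W

nfFuel-[] : ∀ f m → nfFuel f m [] ≡ node []
nfFuel-[] zero    m = refl
nfFuel-[] (suc f) m = refl

piece-bounds : ∀ {f m W} → All (λ z → m ≤ z × z < suc f + m) W →
               ∀ {z} → z ∈ W × m < z → suc m ≤ z × z < f + suc m
piece-bounds {f} {m} bounds {z} (z∈W , m<z) = m<z , subst (z <_) (sym (+-suc f m)) (proj₂ (All.lookup bounds z∈W))

nfFuel-irrelevant : ∀ f f′ m W → All (λ z → m ≤ z × z < f + m) W → All (λ z → m ≤ z × z < f′ + m) W →
                    nfFuel f m W ≡ nfFuel f′ m W
nfFuel-irrelevant f f′ m [] _ _ = trans (nfFuel-[] f m) (sym (nfFuel-[] f′ m))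
nfFuel-irrelevant zero f′ m (x ∷ xs) ((m≤x , x<m) ∷ _) _ = contradiction x<m (≤⇒≯ m≤x)
nfFuel-irrelevant (suc f) zero m (x ∷ xs) _ ((m≤x , x<m) ∷ _) = contradiction x<m (≤⇒≯ m≤x)
nfFuel-irrelevant (suc f) (suc f′) m W@(x ∷ xs) bounds bounds′ =
  cong (node ∘′ greedy) (map-cong-local (All.map onPiece (splitOn-pieces m W (All.map proj₁ bounds))))
  where
  onPiece : ∀ {P} → All (λ z → z ∈ W × m < z) P → nfFuel f (suc m) P ≡ nfFuel f′ (suc m) P
  onPiece inW = nfFuel-irrelevant f f′ (suc m) _ (All.map (piece-bounds bounds) inW) (All.map (piece-bounds bounds′) inW)

nfAt-fuel : ∀ {m W} → All (m ≤_) W → All (λ z → m ≤ z × z < suc (max 0 W) + m) W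
nfAt-fuel {m} {W} m≤W = All.zipWith (λ (m≤z , z≤max) → m≤z , s≤s (≤-trans z≤max (m≤m+n _ m))) (m≤W , xs≤max 0 W)

nfAt-∷ : ∀ {m} x xs → All (m ≤_) (x ∷ xs) → nfAt m (x ∷ xs) ≡ node (greedy (map (nfAt (suc m)) (splitOn m (x ∷ xs))))
nfAt-∷ {m} x xs m≤W = cong (node ∘′ greedy) (map-cong-local (All.map onPiece (splitOn-pieces m (x ∷ xs) m≤W)))
  where
  onPiece : ∀ {P} → All (λ z → z ∈ x ∷ xs × m < z) P → nfFuel (max 0 (x ∷ xs)) (suc m) P ≡ nfAt (suc m) P
  onPiece inW = nfFuel-irrelevant _ _ (suc m) _ (All.map (piece-bounds (nfAt-fuel m≤W)) inW) (nfAt-fuel (All.map proj₂ inW))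

nfAt-above : ∀ {m} x xs → All (m <_) (x ∷ xs) → nfAt m (x ∷ xs) ≡ node (nfAt (suc m) (x ∷ xs) ∷ [])
nfAt-above {m} x xs m<W rewrite nfAt-∷ x xs (All.map <⇒≤ m<W) | splitOn-above m (x ∷ xs) m<W = refl

node[]≺nfAt : ∀ m x xs → node [] ≺ nfAt m (x ∷ xs)
node[]≺nfAt m x xs with splitOn-nonempty m (x ∷ xs)
... | w , ws , split rewrite split = []-≺*-greedy-∷ (f w) (map f ws)
  where f = nfFuel (max 0 (x ∷ xs)) (suc m)

[-]-≼*⇔ : ∀ {x y} → (x ∷ []) ≼* (y ∷ []) ⇔ x ≼ y
[-]-≼*⇔ {x} {y} = mk⇔ (λ p (lt q) → p (lt (trans (then-EQ (compare y x)) q)))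
                       (λ p (lt q) → p (lt (trans (sym (then-EQ (compare y x))) q)))

nfAt-≼⇔-step : ∀ {m A B} → All (m <_) A → All (m <_) B → nfAt m A ≼ nfAt m B ⇔ nfAt (suc m) A ≼ nfAt (suc m) B
nfAt-≼⇔-step {m} {[]}     _ _  = mk⇔ (λ _ → []-≼ _) (λ _ → []-≼ _)
nfAt-≼⇔-step {m} {a ∷ as} {[]} _ _ =
  mk⇔ (contradiction (node[]≺nfAt m a as)) (contradiction (node[]≺nfAt (suc m) a as))
nfAt-≼⇔-step {m} {a ∷ as} {b ∷ bs} m<A m<B rewrite nfAt-above a as m<A | nfAt-above b bs m<B = [-]-≼*⇔

nfAt-≼⇔-raise : ∀ {m n A B} → m ≤′ n → All (n ≤_) A → All (n ≤_) B → nfAt m A ≼ nfAt m B ⇔ nfAt n A ≼ nfAt n B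
nfAt-≼⇔-raise ≤′-refl       _   _   = ⇔-id _
nfAt-≼⇔-raise (≤′-step m≤′n) n<A n<B =
  nfAt-≼⇔-step n<A n<B ⇔-∘ nfAt-≼⇔-raise m≤′n (All.map <⇒≤ n<A) (All.map <⇒≤ n<B)

[node[]]-≼* : ∀ {r} → [] ≺* r → (node [] ∷ []) ≼* r
[node[]]-≼* {t ∷ ts} _ (lt q) with ≺-tri t (node [])
... | tri< t≺[] _ _ = []-≼ t t≺[]
... | tri≈ _ refl _ with ts | q
...   | []    | ()
...   | _ ∷ _ | ()
[node[]]-≼* {t ∷ ts} _ ts≺ | tri> _ _ []≺t = ≺-asym (∷-≺* [] ts []≺t) ts≺

[node[]]-≺*-greedy : ∀ {L} → 2 ≤ length L → (node [] ∷ []) ≺* greedy L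
[node[]]-≺*-greedy {_ ∷ []} (s≤s ())
[node[]]-≺*-greedy {t₁ ∷ t₂ ∷ L} _ = ≺-≼-trans ≺*-firstTwo (sub-≼*-greedy (node []) (t₁ ∷ t₂ ∷ L) firstTwo)
  where
  firstTwo : IndexCollection (length (t₁ ∷ t₂ ∷ L)) (1 ∷ 2 ∷ [])
  firstTwo = (s≤s (s≤s z≤n) ∷ [-]) , (s≤s z≤n , s≤s z≤n) ∷ (s≤s z≤n , s≤s (s≤s z≤n)) ∷ []
  ≺*-firstTwo : (node [] ∷ []) ≺* (t₁ ∷ t₂ ∷ [])
  ≺*-firstTwo with ≺-tri (node []) t₁
  ... | tri< []≺t₁ _ _ = ∷-≺* [] (t₂ ∷ []) []≺t₁
  ... | tri≈ _ refl _ = lt refl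
  ... | tri> _ _ t₁≺[] = contradiction t₁≺[] ([]-≼ t₁)

levelTrees-≼⇔ : ∀ {n A B} → All (n ≤_) A → All (n ≤_) B → n ∈ A ++ B →
  greedy (map (nfAt (suc n)) (splitOn n A)) ≼* greedy (map (nfAt (suc n)) (splitOn n B)) ⇔ nfAt n A ≼ nfAt n B
levelTrees-≼⇔ {n} {[]} {b ∷ bs} _ _ _ with splitOn-nonempty n (b ∷ bs)
... | w , ws , split rewrite split =
  mk⇔ (λ _ → []-≼ _) (λ _ → [node[]]-≼* ([]-≺*-greedy-∷ (nfAt (suc n) w) (map (nfAt (suc n)) ws)))
levelTrees-≼⇔ {n} {a ∷ as} {[]} _ _ n∈A =
  mk⇔ (contradiction ([node[]]-≺*-greedy {map (nfAt (suc n)) (splitOn n (a ∷ as))} twoPieces)) (contradiction (node[]≺nfAt n a as))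
  where
  twoPieces : 2 ≤ length (map (nfAt (suc n)) (splitOn n (a ∷ as)))
  twoPieces rewrite length-map (nfAt (suc n)) (splitOn n (a ∷ as)) =
    splitOn-∈ n (a ∷ as) (subst (n ∈_) (++-identityʳ (a ∷ as)) n∈A)
levelTrees-≼⇔ {n} {a ∷ as} {b ∷ bs} n≤A n≤B _ rewrite nfAt-∷ a as n≤A | nfAt-∷ b bs n≤B = ⇔-id _

module ⇔-Reasoning = SetoidReasoning (⇔-setoid 0ℓ)

leqF-unfold : ∀ d A B {x xs} → A ++ B ≡ x ∷ xs →
  leqF (suc d) A B ⇔ MaximalsLexLe (leqF d) (splitOn (minFrom x xs) A) (splitOn (minFrom x xs) B)
leqF-unfold d A B eq with A ++ B | eq
... | _ | refl = mk⇔ (λ p → p) (λ p → p)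

-- The budget convention of leqF: nothing is consumed when A ++ B = Λ.
EnoughFuel : ℕ → Word → Set
EnoughFuel d []       = ⊤
EnoughFuel d (x ∷ xs) = range (x ∷ xs) < d

mutual
  leqF⇔nfAt : ∀ d m A B → EnoughFuel d (A ++ B) → All (m ≤_) A → All (m ≤_) B → leqF d A B ⇔ nfAt m A ≼ nfAt m B
  leqF⇔nfAt d       m []       []       _    _ _ = mk⇔ (λ _ → ≼-refl) (λ _ → tt)
  leqF⇔nfAt zero    m []       (_ ∷ _)  ()
  leqF⇔nfAt zero    m (_ ∷ _)  _        ()
  leqF⇔nfAt (suc d) m []       (b ∷ bs) fuel = leqF-suc⇔nfAt d m [] (b ∷ bs) refl fuel
  leqF⇔nfAt (suc d) m (a ∷ as) B        fuel = leqF-suc⇔nfAt d m (a ∷ as) B refl fuel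

  leqF-suc⇔nfAt : ∀ d m A B {x xs} → A ++ B ≡ x ∷ xs → range (x ∷ xs) < suc d →
                  All (m ≤_) A → All (m ≤_) B → leqF (suc d) A B ⇔ nfAt m A ≼ nfAt m B
  leqF-suc⇔nfAt d m A B {x} {xs} eq fuel m≤A m≤B =
    begin
      leqF (suc d) A B
        ≈⟨ leqF-unfold d A B eq ⟩
      MaximalsLexLe (leqF d) (splitOn n A) (splitOn n B)
        ≈⟨ maximalsLexLe⇔greedy-≼* rep (pieces-in A ∈-++⁺ˡ n≤A) (pieces-in B (∈-++⁺ʳ A) n≤B) ⟩
      greedy (map (nfAt (suc n)) (splitOn n A)) ≼* greedy (map (nfAt (suc n)) (splitOn n B))
        ≈⟨ levelTrees-≼⇔ n≤A n≤B n∈AB ⟩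
      nfAt n A ≼ nfAt n B
        ≈⟨ ⇔-sym (nfAt-≼⇔-raise (≤⇒≤′ m≤n) n≤A n≤B) ⟩
      nfAt m A ≼ nfAt m B ∎
    where
    open ⇔-Reasoning
    n = minFrom x xs
    inAB : ∀ {z} → z ∈ A ++ B → z ∈ x ∷ xs
    inAB = subst (_ ∈_) eq
    n∈AB : n ∈ A ++ B
    n∈AB = subst (n ∈_) (sym eq) (minFrom-∈ x xs)
    n≤AB : All (n ≤_) (A ++ B)
    n≤AB = subst (All (n ≤_)) (sym eq) (minFrom≤ x xs)
    n≤A = All.++⁻ˡ A n≤AB
    n≤B = All.++⁻ʳ A n≤AB
    m≤n : m ≤ n
    m≤n = All.lookup (All.++⁺ m≤A m≤B) n∈AB

    Piece : Word → Set
    Piece = All (λ z → z ∈ x ∷ xs × n < z)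

    pieces-in : ∀ W → (∀ {z} → z ∈ W → z ∈ A ++ B) → All (n ≤_) W → All Piece (splitOn n W)
    pieces-in W W⊆AB n≤W = All.map (All.map (λ (z∈W , n<z) → inAB (W⊆AB z∈W) , n<z)) (splitOn-pieces n W n≤W)

    enoughFuel : ∀ Z → Piece Z → EnoughFuel d Z
    enoughFuel []      _     = tt
    enoughFuel (z ∷ zs) piece = <-≤-trans (range-< x xs piece) (≤-pred fuel)

    rep : Represents (leqF d) (nfAt (suc n)) Piece
    rep {P} {Q} pP pQ = leqF⇔nfAt d (suc n) P Q (enoughFuel (P ++ Q) (All.++⁺ pP pQ)) (All.map proj₂ pP) (All.map proj₂ pQ)

nf : Word → Tree
nf = nfAt 0

≾⇔nf : ∀ A B → A ≾ B ⇔ nf A ≼ nf B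
≾⇔nf A B = leqF⇔nfAt (suc (range (A ++ B))) 0 A B (enoughFuel-range (A ++ B)) (All.tabulate (λ _ → z≤n)) (All.tabulate (λ _ → z≤n))
  where
  enoughFuel-range : ∀ W → EnoughFuel (suc (range W)) W
  enoughFuel-range []      = tt
  enoughFuel-range (_ ∷ _) = n<1+n _

≾-represents : Represents _≾_ nf (λ _ → ⊤)
≾-represents _ _ = ≾⇔nf _ _

all-⊤ : ∀ (Ws : List Word) → All (λ _ → ⊤) Ws
all-⊤ _ = All.tabulate (λ _ → tt)

lemma2 : (As Bs : List Word) → 0 < length As → 0 < length Bs →
    (g : List ℕ) (h₁ : ℕ) (hs : List ℕ) →
    IsMaximalFor _≾_ As g → IsMaximalFor _≾_ Bs (h₁ ∷ hs) →
    (k : ℕ) → k ≤ length g →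
    (k ≡ 0 ⊎ (1 ≤ k × at [] Bs h₁ ≾ at [] As (at 0 g k))) →
    ((i : ℕ) → k < i → i ≤ length g → ¬ (at [] Bs h₁ ≾ at [] As (at 0 g i))) →
    IsMaximalFor _≾_ (As ++ Bs) (take k g ++ map (length As +_) (h₁ ∷ hs))
lemma2 As Bs _ _ g h₁ hs maxg maxh k k≤ lastAbove notAbove
  with to (isMaximalFor⇔greedy ≾-represents (all-⊤ As)) maxg | to (isMaximalFor⇔greedy ≾-represents (all-⊤ Bs)) maxh
... | icg , eqg | ich , eqh =
  from (isMaximalFor⇔greedy ≾-represents (all-⊤ (As ++ Bs)))
    ( subst (λ n → IndexCollection n _) (sym (length-++ As)) (IndexCollection-++-shift (IndexCollection-take k icg) ich)
    , (begin
        map nf (sub (As ++ Bs) (take k g ++ map (length As +_) (h₁ ∷ hs)))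
          ≡⟨ cong (map nf) (sub-take-++-shift As Bs k icg (IndexCollection-positive ich)) ⟩
        map nf (take k (sub As g) ++ sub Bs (h₁ ∷ hs))
          ≡⟨ trans (map-++ nf (take k (sub As g)) _) (cong (_++ _) (sym (take-map k (sub As g)))) ⟩
        take k (map nf (sub As g)) ++ map nf (sub Bs (h₁ ∷ hs))
          ≡⟨ cong₂ (λ u v → take k u ++ v) eqg eqh ⟩
        take k (greedy (map nf As)) ++ greedy (map nf Bs)
          ≡⟨ greedy-++-take (map nf As) k (sym eqh) (subst (k ≤_) (sym len) k≤) lastAbove′ below ⟨
        greedy (map nf As ++ map nf Bs)
          ≡⟨ cong greedy (map-++ nf As Bs) ⟨
        greedy (map nf (As ++ Bs)) ∎))
  where
  open ≡-Reasoning
  y = nf (at [] Bs h₁)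
  len : length (greedy (map nf As)) ≡ length g
  len = trans (cong length (sym eqg)) (trans (length-map nf (sub As g)) (length-map (at [] As) g))
  Lᵢ : ∀ i → at (node []) (greedy (map nf As)) i ≡ nf (at [] As (at 0 g i))
  Lᵢ i = trans (cong (λ L → at (node []) L i) (sym eqg)) (at-map-sub nf As g i)
  lastAbove′ : k ≡ 0 ⊎ (1 ≤ k × y ≼ at (node []) (greedy (map nf As)) k)
  lastAbove′ = Sum.map₂ (Product.map₂ (λ B≾A → subst (y ≼_) (sym (Lᵢ k)) (to (≾⇔nf _ _) B≾A))) lastAbove
  below : ∀ i → k < i → i ≤ length (greedy (map nf As)) → at (node []) (greedy (map nf As)) i ≺ y
  below i k<i i≤ = ≰⇒≻ (λ y≼Lᵢ → notAbove i k<i (subst (i ≤_) len i≤) (from (≾⇔nf _ _) (subst (y ≼_) (Lᵢ i) y≼Lᵢ)))
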